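{- Let \[ h(q) := \sum_{n=1}^{\infty} \frac{(-1)^{n+1} q^{n(n+1)/2}}{1-q^n}. \] Then, as formal power series in $q$, \[ h(q)=\sum_{j=1}^{\infty} q^{j^2}\Bigl(1+2\sum_{i=1}^{j-1} q^{ij} + q^{j^2}\Bigr), \] i.e. $h(q)=\sum_{j\ge1} q^{j^2}(1+2q^{j}+2q^{2j}+\cdots+2q^{j^2-j}+q^{j^2})$. -}

module Defs where

open import Data.Nat as ℕ using (ℕ; zero; suc; _∸_; _≟_)
open import Data.Nat.DivMod using (_/_)
open import Data.Integer as ℤ using (ℤ; +_; -1ℤ; 1ℤ; 0ℤ)
open import Relation.Nullary using (yes; no)
open import Relation.Binary.PropositionalEquality using (_≡_)

Series : Set
Series = ℕ → ℤ

-- Σ_{k=a}^{b} f k  (empty, i.e. 0, if b < a)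
sumFromTo : ℕ → ℕ → (ℕ → ℤ) → ℤ
sumFromTo a zero    f with a ≟ 0
... | yes _ = f 0
... | no  _ = 0ℤ
sumFromTo a (suc b) f with a ℕ.≤? suc b
... | yes _ = sumFromTo a b f ℤ.+ f (suc b)
... | no  _ = 0ℤ

mono : ℕ → Series
mono m N with N ≟ m
... | yes _ = 1ℤ
... | no  _ = 0ℤ

infixl 6 _⊕_
infixr 7 _·_
infixl 7 _⊛_
infix 4 _≈ₛ_

_⊕_ : Series → Series → Series
(f ⊕ g) N = f N ℤ.+ g N

_·_ : ℤ → Series → Series
(c · f) N = c ℤ.* f N

_⊛_ : Series → Series → Series
(f ⊛ g) N = sumFromTo 0 N (λ k → f k ℤ.* g (N ∸ k))

finSum : ℕ → ℕ → (ℕ → Series) → Series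
finSum a b F N = sumFromTo a b (λ i → F i N)

-- Infinite sum Σ_{n ≥ a} F n of a family of series, for a ∈ {0,1}, where
-- F n has q-adic order ≥ n (all families used below satisfy this), so the
-- coefficient of q^N only receives contributions from n ≤ N.
infSumFrom : ℕ → (ℕ → Series) → Series
infSumFrom a F N = sumFromTo a N (λ n → F n N)

-- 1/(1 - q^n) = Σ_{k ≥ 0} q^{n k}   (for n ≥ 1)
geom : ℕ → Series
geom n = infSumFrom 0 (λ k → mono (n ℕ.* k))

h : Series
h = infSumFrom 1 (λ n → (-1ℤ ℤ.^ suc n) · (mono ((n ℕ.* suc n) / 2) ⊛ geom n))

rhs : Series
rhs = infSumFrom 1 (λ j →
        mono (j ℕ.* j) ⊛
          (mono 0 ⊕ ((+ 2) · finSum 1 (j ∸ 1) (λ i → mono (i ℕ.* j)))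
                  ⊕ mono (j ℕ.* j)))

_≈ₛ_ : Series → Series → Set
f ≈ₛ g = ∀ N → f N ≡ g N

-- Both coefficients of q^N (N ≥ 1) are weighted counts of the factorisations N = u v.
-- On the right, q^(j²) q^(i j) = q^(j (j + i)), so the weight of (u, v) is
-- [u ≤ v < 2u] + [u < v ≤ 2u]; exchanging u and v in the second indicator turns the
-- total weight into [u ≤ 2v] − [2u ≤ v].  On the left, q^(n(n+1)/2) q^(n k) is q^N
-- exactly when N = n v with v = (n + 1)/2 + k for odd n, and N = j (2b + 1) with
-- b = j + k for n = 2j.  So the odd summands count the pairs (u, v) with u odd and
-- u ≤ 2v, and the even summands, with sign −1, the pairs with v odd and 2u ≤ v.
-- Splitting [u ≤ 2v] by the parity of u and [2u ≤ v] by the parity of v, the two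
-- remaining even parts both count the pairs (2a, b) with a ≤ b, and cancel.

module Submission where

open import Defs
open import Data.Nat using (ℕ; zero; suc; _∸_; _≟_; _≤_; _<_; z≤n; s≤s; _≤?_; _<?_; _+_; _*_)
import Data.Nat.Properties as ℕₚ
open import Data.Integer as ℤ using (ℤ; -1ℤ; 1ℤ; 0ℤ)
import Data.Integer.Properties as ℤₚ
open import Algebra.Properties.CommutativeSemigroup ℤₚ.+-commutativeSemigroup using (interchange)
open import Algebra.Properties.Ring ℤₚ.+-*-ring using (x[y-z]≈xy-xz)
open import Data.Empty using (⊥-elim)
open import Data.Sum using (_⊎_; inj₁; inj₂)
import Data.Nat.DivMod as DivMod
open DivMod using (_/_)
open import Function using (_∘_)
open import Relation.Nullary using (Dec; yes; no; ¬_)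
open import Relation.Binary.PropositionalEquality
  using (_≡_; _≢_; refl; sym; trans; cong; cong₂; subst; module ≡-Reasoning)
import Data.Integer.Tactic.RingSolver as ℤ-Ring
import Data.Nat.Tactic.RingSolver as ℕ-Ring

∑< : ℕ → (ℕ → ℤ) → ℤ
∑< zero    f = 0ℤ
∑< (suc n) f = ∑< n f ℤ.+ f n

syntax ∑< n (λ x → e) = ∑[ x < n ] e

∑<-cong : ∀ n {f g : ℕ → ℤ} → (∀ x → x < n → f x ≡ g x) → ∑< n f ≡ ∑< n g
∑<-cong zero    _  = refl
∑<-cong (suc n) eq = cong₂ ℤ._+_ (∑<-cong n (λ x x<n → eq x (ℕₚ.m≤n⇒m≤1+n x<n))) (eq n ℕₚ.≤-refl)

∑<-zero : ∀ n {f : ℕ → ℤ} → (∀ x → x < n → f x ≡ 0ℤ) → ∑< n f ≡ 0ℤ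
∑<-zero zero    _  = refl
∑<-zero (suc n) eq rewrite ∑<-zero n (λ x x<n → eq x (ℕₚ.m≤n⇒m≤1+n x<n)) | eq n ℕₚ.≤-refl = refl

∑<-+ : ∀ n (f g : ℕ → ℤ) → ∑[ x < n ] (f x ℤ.+ g x) ≡ ∑< n f ℤ.+ ∑< n g
∑<-+ zero    f g = refl
∑<-+ (suc n) f g rewrite ∑<-+ n f g = interchange (∑< n f) (∑< n g) (f n) (g n)

∑<-- : ∀ n (f g : ℕ → ℤ) → ∑[ x < n ] (f x ℤ.- g x) ≡ ∑< n f ℤ.- ∑< n g
∑<-- zero    f g = refl
∑<-- (suc n) f g rewrite ∑<-- n f g = lemma (∑< n f) (∑< n g) (f n) (g n)
  where
  lemma : ∀ a b c d → (a ℤ.- b) ℤ.+ (c ℤ.- d) ≡ (a ℤ.+ c) ℤ.- (b ℤ.+ d)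
  lemma = ℤ-Ring.solve-∀

∑<-*ˡ : ∀ n c (f : ℕ → ℤ) → ∑[ x < n ] (c ℤ.* f x) ≡ c ℤ.* ∑< n f
∑<-*ˡ zero    c f = sym (ℤₚ.*-zeroʳ c)
∑<-*ˡ (suc n) c f rewrite ∑<-*ˡ n c f = sym (ℤₚ.*-distribˡ-+ c (∑< n f) (f n))

∑<-suc : ∀ n (f : ℕ → ℤ) → ∑< (suc n) f ≡ f 0 ℤ.+ ∑< n (f ∘ suc)
∑<-suc zero    f = ℤₚ.+-comm 0ℤ (f 0)
∑<-suc (suc n) f rewrite ∑<-suc n f = ℤₚ.+-assoc (f 0) (∑< n (f ∘ suc)) (f (suc n))

∑<-split : ∀ m n (f : ℕ → ℤ) → ∑< (m + n) f ≡ ∑< m f ℤ.+ ∑[ x < n ] f (m + x)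
∑<-split m zero    f rewrite ℕₚ.+-identityʳ m = sym (ℤₚ.+-identityʳ (∑< m f))
∑<-split m (suc n) f rewrite ℕₚ.+-suc m n | ∑<-split m n f =
  ℤₚ.+-assoc (∑< m f) (∑[ x < n ] f (m + x)) (f (m + n))

∑<-vanishing : ∀ {m n} {f : ℕ → ℤ} → m ≤ n → (∀ x → m ≤ x → x < n → f x ≡ 0ℤ) → ∑< n f ≡ ∑< m f
∑<-vanishing {m} {n} {f} m≤n tail = begin
  ∑< n f                                ≡⟨ cong (λ k → ∑< k f) (sym (ℕₚ.m+[n∸m]≡n m≤n)) ⟩
  ∑< (m + (n ∸ m)) f                    ≡⟨ ∑<-split m (n ∸ m) f ⟩
  ∑< m f ℤ.+ ∑[ x < n ∸ m ] f (m + x)   ≡⟨ cong (λ s → ∑< m f ℤ.+ s) (∑<-zero (n ∸ m) tail′) ⟩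
  ∑< m f ℤ.+ 0ℤ                         ≡⟨ ℤₚ.+-identityʳ (∑< m f) ⟩
  ∑< m f                                ∎
  where
  open ≡-Reasoning
  tail′ : ∀ x → x < n ∸ m → f (m + x) ≡ 0ℤ
  tail′ x x<n∸m = tail (m + x) (ℕₚ.m≤m+n m x)
    (subst (m + x <_) (ℕₚ.m+[n∸m]≡n m≤n) (ℕₚ.+-monoʳ-< m x<n∸m))

∑<-parity : ∀ n (f : ℕ → ℤ) → ∑< (n + n) f ≡ ∑[ j < n ] (f (j + j) ℤ.+ f (suc (j + j)))
∑<-parity zero    f = refl
∑<-parity (suc n) f rewrite ℕₚ.+-suc n n | ∑<-parity n f =
  ℤₚ.+-assoc (∑[ j < n ] (f (j + j) ℤ.+ f (suc (j + j)))) (f (n + n)) (f (suc (n + n)))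

∑<-swap : ∀ m n (F : ℕ → ℕ → ℤ) → ∑[ x < m ] ∑[ y < n ] F x y ≡ ∑[ y < n ] ∑[ x < m ] F x y
∑<-swap zero    n F = sym (∑<-zero n (λ _ _ → refl))
∑<-swap (suc m) n F rewrite ∑<-swap m n F = sym (∑<-+ n (λ y → ∑[ x < m ] F x y) (λ y → F m y))

∑<-single : ∀ {n} {f : ℕ → ℤ} t → t < n → (∀ x → x < n → x ≢ t → f x ≡ 0ℤ) → ∑< n f ≡ f t
∑<-single {suc n} {f} t t<1+n others with t ≟ n
... | yes refl = begin
  ∑< n f ℤ.+ f n ≡⟨ cong (ℤ._+ f n) (∑<-zero n (λ x x<n → others x (ℕₚ.m≤n⇒m≤1+n x<n) (ℕₚ.<⇒≢ x<n))) ⟩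
  0ℤ ℤ.+ f n     ≡⟨ ℤₚ.+-identityˡ (f n) ⟩
  f n            ∎
  where open ≡-Reasoning
... | no t≢n = begin
  ∑< n f ℤ.+ f n ≡⟨ cong₂ ℤ._+_ (∑<-single t (ℕₚ.≤∧≢⇒< (ℕₚ.≤-pred t<1+n) t≢n) (λ x x<n → others x (ℕₚ.m≤n⇒m≤1+n x<n)))
                                (others n ℕₚ.≤-refl (t≢n ∘ sym)) ⟩
  f t ℤ.+ 0ℤ     ≡⟨ ℤₚ.+-identityʳ (f t) ⟩
  f t            ∎
  where open ≡-Reasoning

overlapping-sums : ∀ n (x : ℕ → ℤ) →
                   x 0 ℤ.+ ℤ.+ 2 ℤ.* ∑< n (x ∘ suc) ℤ.+ x (suc n) ≡ ∑< (suc n) x ℤ.+ ∑< (suc n) (x ∘ suc)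
overlapping-sums n x rewrite ∑<-suc n x = lemma (x 0) (∑< n (x ∘ suc)) (x (suc n))
  where
  lemma : ∀ a s b → a ℤ.+ ℤ.+ 2 ℤ.* s ℤ.+ b ≡ a ℤ.+ s ℤ.+ (s ℤ.+ b)
  lemma = ℤ-Ring.solve-∀

𝟙 : ∀ {p} {P : Set p} → Dec P → ℤ
𝟙 (yes _) = 1ℤ
𝟙 (no _)  = 0ℤ

module _ {p} {P : Set p} where

  𝟙-yes : (d : Dec P) → P → 𝟙 d ≡ 1ℤ
  𝟙-yes (yes _) _  = refl
  𝟙-yes (no ¬P) pf = ⊥-elim (¬P pf)

  𝟙-no : (d : Dec P) → ¬ P → 𝟙 d ≡ 0ℤ
  𝟙-no (yes pf) ¬P = ⊥-elim (¬P pf)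
  𝟙-no (no _)   _  = refl

  𝟙-cong : ∀ {q} {Q : Set q} (d : Dec P) (e : Dec Q) → (P → Q) → (Q → P) → 𝟙 d ≡ 𝟙 e
  𝟙-cong (yes _)  (yes _)  _ _ = refl
  𝟙-cong (yes pf) (no ¬Q)  f _ = ⊥-elim (¬Q (f pf))
  𝟙-cong (no ¬P)  (yes qf) _ g = ⊥-elim (¬P (g qf))
  𝟙-cong (no _)   (no _)   _ _ = refl

𝟙-<-complement : ∀ m n → 𝟙 (m <? n) ≡ 1ℤ ℤ.- 𝟙 (n ≤? m)
𝟙-<-complement m n with m <? n | n ≤? m
... | yes m<n | yes n≤m = ⊥-elim (ℕₚ.<⇒≱ m<n n≤m)
... | yes _   | no _    = refl
... | no _    | yes _   = refl
... | no m≮n  | no n≰m  = ⊥-elim (m≮n (ℕₚ.≰⇒> n≰m))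

∑<-from : ∀ {a m} (g : ℕ → ℤ) → a ≤ m → ∑[ v < m ] (g v ℤ.* 𝟙 (a ≤? v)) ≡ ∑[ i < m ∸ a ] g (a + i)
∑<-from {a} {m} g a≤m = begin
  ∑[ v < m ] (g v ℤ.* 𝟙 (a ≤? v))
    ≡⟨ cong (λ k → ∑[ v < k ] (g v ℤ.* 𝟙 (a ≤? v))) (sym (ℕₚ.m+[n∸m]≡n a≤m)) ⟩
  ∑[ v < a + (m ∸ a) ] (g v ℤ.* 𝟙 (a ≤? v))
    ≡⟨ ∑<-split a (m ∸ a) _ ⟩
  ∑[ v < a ] (g v ℤ.* 𝟙 (a ≤? v)) ℤ.+ ∑[ i < m ∸ a ] (g (a + i) ℤ.* 𝟙 (a ≤? a + i))
    ≡⟨ cong₂ ℤ._+_ (∑<-zero a below) (∑<-cong (m ∸ a) above) ⟩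
  0ℤ ℤ.+ ∑[ i < m ∸ a ] g (a + i)
    ≡⟨ ℤₚ.+-identityˡ _ ⟩
  ∑[ i < m ∸ a ] g (a + i) ∎
  where
  open ≡-Reasoning
  below : ∀ v → v < a → g v ℤ.* 𝟙 (a ≤? v) ≡ 0ℤ
  below v v<a rewrite 𝟙-no (a ≤? v) (ℕₚ.<⇒≱ v<a) = ℤₚ.*-zeroʳ (g v)
  above : ∀ i → i < m ∸ a → g (a + i) ℤ.* 𝟙 (a ≤? a + i) ≡ g (a + i)
  above i _ rewrite 𝟙-yes (a ≤? a + i) (ℕₚ.m≤m+n a i) = ℤₚ.*-identityʳ (g (a + i))

∑<-from-support : ∀ {a m K} (g : ℕ → ℤ) → (∀ v → K ≤ v → g v ≡ 0ℤ) → a ≤ m → K ≤ m →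
                  ∑[ v < m ] (g v ℤ.* 𝟙 (a ≤? v)) ≡ ∑[ i < K ] g (a + i)
∑<-from-support {a} {m} {K} g support a≤m K≤m =
  trans (∑<-from g a≤m) (resize (ℕₚ.≤-total K (m ∸ a)))
  where
  resize : K ≤ m ∸ a ⊎ m ∸ a ≤ K → ∑[ i < m ∸ a ] g (a + i) ≡ ∑[ i < K ] g (a + i)
  resize (inj₁ K≤m∸a) = ∑<-vanishing K≤m∸a (λ i K≤i _ → support (a + i) (ℕₚ.≤-trans K≤i (ℕₚ.m≤n+m i a)))
  resize (inj₂ m∸a≤K) = sym (∑<-vanishing m∸a≤K (λ i m∸a≤i _ → support (a + i)
    (ℕₚ.≤-trans K≤m (subst (_≤ a + i) (ℕₚ.m+[n∸m]≡n a≤m) (ℕₚ.+-monoʳ-≤ a m∸a≤i)))))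

∑<-interval : ∀ {a b m} (g : ℕ → ℤ) → a ≤ b → b ≤ m →
              ∑[ v < m ] (g v ℤ.* (𝟙 (a ≤? v) ℤ.* 𝟙 (v <? b))) ≡ ∑[ i < b ∸ a ] g (a + i)
∑<-interval {a} {b} {m} g a≤b b≤m = begin
  ∑[ v < m ] (g v ℤ.* (𝟙 (a ≤? v) ℤ.* 𝟙 (v <? b)))
    ≡⟨ ∑<-cong m (λ v _ → reassoc (g v) (𝟙 (a ≤? v)) (𝟙 (v <? b))) ⟩
  ∑[ v < m ] (g v ℤ.* 𝟙 (v <? b) ℤ.* 𝟙 (a ≤? v))
    ≡⟨ ∑<-from (λ v → g v ℤ.* 𝟙 (v <? b)) (ℕₚ.≤-trans a≤b b≤m) ⟩
  ∑[ i < m ∸ a ] (g (a + i) ℤ.* 𝟙 (a + i <? b))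
    ≡⟨ ∑<-vanishing (ℕₚ.∸-monoˡ-≤ a b≤m) beyond ⟩
  ∑[ i < b ∸ a ] (g (a + i) ℤ.* 𝟙 (a + i <? b))
    ≡⟨ ∑<-cong (b ∸ a) within ⟩
  ∑[ i < b ∸ a ] g (a + i) ∎
  where
  open ≡-Reasoning
  reassoc : ∀ x y z → x ℤ.* (y ℤ.* z) ≡ x ℤ.* z ℤ.* y
  reassoc = ℤ-Ring.solve-∀
  beyond : ∀ i → b ∸ a ≤ i → i < m ∸ a → g (a + i) ℤ.* 𝟙 (a + i <? b) ≡ 0ℤ
  beyond i b∸a≤i _ = trans (cong (g (a + i) ℤ.*_) (𝟙-no (a + i <? b) (ℕₚ.≤⇒≯ b≤a+i))) (ℤₚ.*-zeroʳ (g (a + i)))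
    where
    b≤a+i : b ≤ a + i
    b≤a+i = subst (_≤ a + i) (ℕₚ.m+[n∸m]≡n a≤b) (ℕₚ.+-monoʳ-≤ a b∸a≤i)
  within : ∀ i → i < b ∸ a → g (a + i) ℤ.* 𝟙 (a + i <? b) ≡ g (a + i)
  within i i<b∸a = trans (cong (g (a + i) ℤ.*_) (𝟙-yes (a + i <? b) a+i<b)) (ℤₚ.*-identityʳ (g (a + i)))
    where
    a+i<b : a + i < b
    a+i<b = subst (a + i <_) (ℕₚ.m+[n∸m]≡n a≤b) (ℕₚ.+-monoʳ-< a i<b∸a)

sumFromTo-0 : ∀ b (f : ℕ → ℤ) → sumFromTo 0 b f ≡ ∑< (suc b) f
sumFromTo-0 zero    f = sym (ℤₚ.+-identityˡ (f 0))
sumFromTo-0 (suc b) f rewrite sumFromTo-0 b f = refl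

sumFromTo-1 : ∀ b (f : ℕ → ℤ) → sumFromTo 1 b f ≡ ∑< b (f ∘ suc)
sumFromTo-1 zero    f = refl
sumFromTo-1 (suc b) f rewrite sumFromTo-1 b f = refl

mono-𝟙 : ∀ m N → mono m N ≡ 𝟙 (N ≟ m)
mono-𝟙 m N with N ≟ m
... | yes _ = refl
... | no _  = refl

mono-≢ : ∀ {m N} → N ≢ m → mono m N ≡ 0ℤ
mono-≢ {m} {N} N≢m = trans (mono-𝟙 m N) (𝟙-no (N ≟ m) N≢m)

mono-refl : ∀ m → mono m m ≡ 1ℤ
mono-refl m = trans (mono-𝟙 m m) (𝟙-yes (m ≟ m) refl)

mono-⊛ : ∀ T g N → (mono T ⊛ g) N ≡ 𝟙 (T ≤? N) ℤ.* g (N ∸ T)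
mono-⊛ T g N = trans (sumFromTo-0 N _) (term (T ≤? N))
  where
  term : (d : Dec (T ≤ N)) → ∑[ k < suc N ] (mono T k ℤ.* g (N ∸ k)) ≡ 𝟙 d ℤ.* g (N ∸ T)
  term (yes T≤N) = trans (∑<-single T (s≤s T≤N) (λ k _ k≢T → cong (ℤ._* g (N ∸ k)) (mono-≢ k≢T)))
                         (cong (ℤ._* g (N ∸ T)) (mono-refl T))
  term (no T≰N)  = ∑<-zero (suc N) (λ k k≤N → cong (ℤ._* g (N ∸ k)) (mono-≢ {T} {k} λ { refl → T≰N (ℕₚ.≤-pred k≤N) }))

mono-shift : ∀ T m N → 𝟙 (T ≤? N) ℤ.* mono m (N ∸ T) ≡ mono (T + m) N
mono-shift T m N with T ≤? N
... | yes T≤N = begin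
  1ℤ ℤ.* mono m (N ∸ T)   ≡⟨ ℤₚ.*-identityˡ _ ⟩
  mono m (N ∸ T)          ≡⟨ mono-𝟙 m (N ∸ T) ⟩
  𝟙 (N ∸ T ≟ m)           ≡⟨ 𝟙-cong (N ∸ T ≟ m) (N ≟ T + m) to from ⟩
  𝟙 (N ≟ T + m)           ≡⟨ sym (mono-𝟙 (T + m) N) ⟩
  mono (T + m) N          ∎
  where
  open ≡-Reasoning
  to : N ∸ T ≡ m → N ≡ T + m
  to refl = sym (ℕₚ.m+[n∸m]≡n T≤N)
  from : N ≡ T + m → N ∸ T ≡ m
  from refl = ℕₚ.m+n∸m≡n T m
... | no T≰N = sym (mono-≢ λ { refl → T≰N (ℕₚ.m≤m+n T m) })

mono-⊛-geom : ∀ T n N → (mono T ⊛ geom (suc n)) N ≡ ∑[ k < suc N ] mono (T + suc n * k) N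
mono-⊛-geom T n N = begin
  (mono T ⊛ geom (suc n)) N
    ≡⟨ mono-⊛ T (geom (suc n)) N ⟩
  𝟙 (T ≤? N) ℤ.* geom (suc n) (N ∸ T)
    ≡⟨ cong (𝟙 (T ≤? N) ℤ.*_) (sumFromTo-0 (N ∸ T) _) ⟩
  𝟙 (T ≤? N) ℤ.* ∑[ k < suc (N ∸ T) ] mono (suc n * k) (N ∸ T)
    ≡⟨ sym (∑<-*ˡ (suc (N ∸ T)) (𝟙 (T ≤? N)) _) ⟩
  ∑[ k < suc (N ∸ T) ] (𝟙 (T ≤? N) ℤ.* mono (suc n * k) (N ∸ T))
    ≡⟨ ∑<-cong (suc (N ∸ T)) (λ k _ → mono-shift T (suc n * k) N) ⟩
  ∑[ k < suc (N ∸ T) ] mono (T + suc n * k) N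
    ≡⟨ sym (∑<-vanishing (s≤s (ℕₚ.m∸n≤m N T)) beyond) ⟩
  ∑[ k < suc N ] mono (T + suc n * k) N ∎
  where
  open ≡-Reasoning
  beyond : ∀ k → suc (N ∸ T) ≤ k → k < suc N → mono (T + suc n * k) N ≡ 0ℤ
  beyond k N∸T<k _ = mono-≢ λ N≡T+nk → ℕₚ.<-irrefl N≡T+nk
    (ℕₚ.<-≤-trans (ℕₚ.≤-<-trans (ℕₚ.m≤n+m∸n N T) (ℕₚ.+-monoʳ-< T N∸T<k))
                  (ℕₚ.+-monoʳ-≤ T (ℕₚ.m≤n*m k (suc n))))

-1^[n+n]≡1 : ∀ n → -1ℤ ℤ.^ (n + n) ≡ 1ℤ
-1^[n+n]≡1 zero    = refl
-1^[n+n]≡1 (suc n) rewrite ℕₚ.+-suc n n | -1^[n+n]≡1 n = refl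

odd-triangle : ∀ j → suc (j + j) * suc (suc (j + j)) / 2 ≡ suc (j + j) * suc j
odd-triangle j = trans (cong (_/ 2) (double j)) (DivMod.m*n/n≡m (suc (j + j) * suc j) 2)
  where
  double : ∀ j → suc (j + j) * suc (suc (j + j)) ≡ suc (j + j) * suc j * 2
  double = ℕ-Ring.solve-∀

even-triangle : ∀ j → (j + j) * suc (j + j) / 2 ≡ j * suc (j + j)
even-triangle j = trans (cong (_/ 2) (double j)) (DivMod.m*n/n≡m (j * suc (j + j)) 2)
  where
  double : ∀ j → (j + j) * suc (j + j) ≡ j * suc (j + j) * 2
  double = ℕ-Ring.solve-∀

n≤triangle : ∀ n → n ≤ n * suc n / 2
n≤triangle zero    = z≤n
n≤triangle (suc n) = subst (_≤ suc n * suc (suc n) / 2) (DivMod.m*n/n≡m (suc n) 2)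
  (DivMod./-monoˡ-≤ 2 (ℕₚ.*-monoʳ-≤ (suc n) {2} {suc (suc n)} (s≤s (s≤s z≤n))))

h-summand rhs-summand : ℕ → Series
h-summand n   = (-1ℤ ℤ.^ suc n) · (mono (n * suc n / 2) ⊛ geom n)
rhs-summand j = mono (j * j) ⊛ (mono 0 ⊕ (ℤ.+ 2) · finSum 1 (j ∸ 1) (λ i → mono (i * j)) ⊕ mono (j * j))

W : ℕ → ℕ → ℤ
W u v = 𝟙 (u ≤? v) ℤ.* 𝟙 (v <? u + u) ℤ.+ 𝟙 (u <? v) ℤ.* 𝟙 (v <? suc (u + u))

-- [u ≤ v < 2u] and [v < u ≤ 2v] split the window 1/2 < u/v ≤ 2 at u/v = 1.
window : ∀ u v → 𝟙 (u ≤? v) ℤ.* 𝟙 (v <? u + u) ℤ.+ 𝟙 (v <? u) ℤ.* 𝟙 (u <? suc (v + v))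
                 ≡ 𝟙 (u ≤? v + v) ℤ.- 𝟙 (u + u ≤? v)
window u v with u ≤? v
... | yes u≤v
  rewrite 𝟙-no (v <? u) (ℕₚ.≤⇒≯ u≤v) | 𝟙-yes (u ≤? v + v) (ℕₚ.≤-trans u≤v (ℕₚ.m≤n+m v v))
        | 𝟙-<-complement v (u + u) = lemma (𝟙 (u + u ≤? v))
  where
  lemma : ∀ x → 1ℤ ℤ.* (1ℤ ℤ.- x) ℤ.+ 0ℤ ≡ 1ℤ ℤ.- x
  lemma = ℤ-Ring.solve-∀
... | no u≰v
  rewrite 𝟙-yes (v <? u) (ℕₚ.≰⇒> u≰v) | 𝟙-no (u + u ≤? v) (λ 2u≤v → u≰v (ℕₚ.≤-trans (ℕₚ.m≤m+n u u) 2u≤v))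
        | 𝟙-cong (u <? suc (v + v)) (u ≤? v + v) ℕₚ.≤-pred s≤s = lemma (𝟙 (u ≤? v + v))
  where
  lemma : ∀ x → 0ℤ ℤ.+ 1ℤ ℤ.* x ≡ x ℤ.- 0ℤ
  lemma = ℤ-Ring.solve-∀

module Coefficient (N′ : ℕ) where

  -- δ u v = [u v = N].  Every factor of N lies below L, and M = L + L leaves room
  -- to split the range of a factor by parity.
  N L M : ℕ
  N = suc N′
  L = suc N
  M = L + L

  δ : ℕ → ℕ → ℤ
  δ u v = mono (u * v) N

  δ-comm : ∀ u v → δ u v ≡ δ v u
  δ-comm u v = cong (λ m → mono m N) (ℕₚ.*-comm u v)

  δ-vanishesˡ : ∀ {u} v → L ≤ u → δ u v ≡ 0ℤ
  δ-vanishesˡ {u} zero L≤u = mono-≢ λ N≡0 → ℕₚ.1+n≢0 (trans N≡0 (ℕₚ.*-zeroʳ u))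
  δ-vanishesˡ {u} (suc v) L≤u = mono-≢ λ N≡uv → ℕₚ.<-irrefl N≡uv
    (ℕₚ.<-≤-trans L≤u (ℕₚ.m≤m*n u (suc v)))

  δ-vanishesʳ : ∀ u {v} → L ≤ v → δ u v ≡ 0ℤ
  δ-vanishesʳ u {v} L≤v = trans (δ-comm u v) (δ-vanishesˡ u L≤v)

  δ-weighted-vanishesˡ : ∀ {u} v x → L ≤ u → δ u v ℤ.* x ≡ 0ℤ
  δ-weighted-vanishesˡ v x L≤u = cong (ℤ._* x) (δ-vanishesˡ v L≤u)

  σ : (ℕ → ℕ → ℤ) → ℤ
  σ w = ∑[ u < M ] ∑[ v < M ] (δ u v ℤ.* w u v)

  σ-cong : ∀ {w w′} → (∀ u v → w u v ≡ w′ u v) → σ w ≡ σ w′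
  σ-cong eq = ∑<-cong M (λ u _ → ∑<-cong M (λ v _ → cong (δ u v ℤ.*_) (eq u v)))

  σ-+ : ∀ w w′ → σ (λ u v → w u v ℤ.+ w′ u v) ≡ σ w ℤ.+ σ w′
  σ-+ w w′ = trans (∑<-cong M (λ u _ → trans (∑<-cong M (λ v _ → ℤₚ.*-distribˡ-+ (δ u v) (w u v) (w′ u v)))
                                             (∑<-+ M _ _)))
                   (∑<-+ M _ _)

  σ-- : ∀ w w′ → σ (λ u v → w u v ℤ.- w′ u v) ≡ σ w ℤ.- σ w′
  σ-- w w′ = trans (∑<-cong M (λ u _ → trans (∑<-cong M (λ v _ → x[y-z]≈xy-xz (δ u v) (w u v) (w′ u v)))
                                             (∑<-- M _ _)))
                   (∑<-- M _ _)

  σ-flip : ∀ w → σ w ≡ σ (λ u v → w v u)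
  σ-flip w = trans (∑<-swap M M _) (∑<-cong M (λ u _ → ∑<-cong M (λ v _ → cong (ℤ._* w v u) (δ-comm v u))))

  L≤M : L ≤ M
  L≤M = ℕₚ.m≤m+n L L

  oddTerm evenTerm : ℕ → ℤ
  oddTerm j  = ∑[ v < M ] (δ (suc (j + j)) v ℤ.* 𝟙 (suc (j + j) ≤? v + v))
  evenTerm j = ∑[ b < L ] (δ j (suc (b + b)) ℤ.* 𝟙 (j + j ≤? suc (b + b)))

  shared : ℤ
  shared = ∑[ a < L ] ∑[ b < L ] (δ (a + a) b ℤ.* 𝟙 (a + a ≤? b + b))

  σ-W : σ W ≡ σ (λ u v → 𝟙 (u ≤? v + v)) ℤ.- σ (λ u v → 𝟙 (u + u ≤? v))
  σ-W = begin
    σ W                                  ≡⟨ σ-+ A B ⟩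
    σ A ℤ.+ σ B                          ≡⟨ cong (ℤ._+_ (σ A)) (σ-flip B) ⟩
    σ A ℤ.+ σ (λ u v → B v u)            ≡⟨ sym (σ-+ A (λ u v → B v u)) ⟩
    σ (λ u v → A u v ℤ.+ B v u)          ≡⟨ σ-cong window ⟩
    σ (λ u v → 𝟙 (u ≤? v + v) ℤ.- 𝟙 (u + u ≤? v))   ≡⟨ σ-- _ _ ⟩
    σ (λ u v → 𝟙 (u ≤? v + v)) ℤ.- σ (λ u v → 𝟙 (u + u ≤? v)) ∎
    where
    open ≡-Reasoning
    A B : ℕ → ℕ → ℤ
    A u v = 𝟙 (u ≤? v) ℤ.* 𝟙 (v <? u + u)
    B u v = 𝟙 (u <? v) ℤ.* 𝟙 (v <? suc (u + u))

  σ-≤-double : σ (λ u v → 𝟙 (u ≤? v + v)) ≡ shared ℤ.+ ∑< L oddTerm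
  σ-≤-double = begin
    ∑< (L + L) G                                   ≡⟨ ∑<-parity L G ⟩
    ∑[ a < L ] (G (a + a) ℤ.+ G (suc (a + a)))    ≡⟨ ∑<-+ L _ _ ⟩
    ∑[ a < L ] G (a + a) ℤ.+ ∑< L oddTerm          ≡⟨ cong (ℤ._+ ∑< L oddTerm) (∑<-cong L (λ a _ → truncate a)) ⟩
    shared ℤ.+ ∑< L oddTerm                        ∎
    where
    open ≡-Reasoning
    G : ℕ → ℤ
    G u = ∑[ v < M ] (δ u v ℤ.* 𝟙 (u ≤? v + v))
    truncate : ∀ a → G (a + a) ≡ ∑[ b < L ] (δ (a + a) b ℤ.* 𝟙 (a + a ≤? b + b))
    truncate a = ∑<-vanishing L≤M (λ v L≤v _ → cong (ℤ._* _) (δ-vanishesʳ (a + a) L≤v))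

  σ-double-≤ : σ (λ u v → 𝟙 (u + u ≤? v)) ≡ shared ℤ.+ ∑< L evenTerm
  σ-double-≤ = begin
    ∑[ u < M ] ∑< (L + L) (K u)
      ≡⟨ ∑<-cong M (λ u _ → trans (∑<-parity L (K u)) (∑<-+ L _ _)) ⟩
    ∑[ u < M ] (∑[ b < L ] K u (b + b) ℤ.+ ∑[ b < L ] K u (suc (b + b)))
      ≡⟨ ∑<-+ M _ _ ⟩
    ∑[ u < M ] ∑[ b < L ] K u (b + b) ℤ.+ ∑[ u < M ] ∑[ b < L ] K u (suc (b + b))
      ≡⟨ cong₂ ℤ._+_ (∑<-vanishing L≤M (λ u L≤u _ → ∑<-zero L (λ b _ → δ-weighted-vanishesˡ (b + b) _ L≤u)))
                     (∑<-vanishing L≤M (λ u L≤u _ → ∑<-zero L (λ b _ → δ-weighted-vanishesˡ (suc (b + b)) _ L≤u))) ⟩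
    ∑[ u < L ] ∑[ b < L ] K u (b + b) ℤ.+ ∑< L evenTerm
      ≡⟨ cong (ℤ._+ ∑< L evenTerm) (∑<-cong L (λ u _ → ∑<-cong L (λ b _ → cong (ℤ._* _) (double-factor u b)))) ⟩
    shared ℤ.+ ∑< L evenTerm ∎
    where
    open ≡-Reasoning
    K : ℕ → ℕ → ℤ
    K u v = δ u v ℤ.* 𝟙 (u + u ≤? v)
    double-factor : ∀ u b → δ u (b + b) ≡ δ (u + u) b
    double-factor u b = cong (λ m → mono m N) (lemma u b)
      where
      lemma : ∀ u b → u * (b + b) ≡ (u + u) * b
      lemma = ℕ-Ring.solve-∀

  H : ℕ → ℤ
  H n = h-summand n N

  H-zero : H 0 ≡ 0ℤ
  H-zero = cong (-1ℤ ℤ.*_) (begin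
    (mono 0 ⊛ geom 0) N           ≡⟨ mono-⊛ 0 (geom 0) N ⟩
    1ℤ ℤ.* geom 0 N               ≡⟨ ℤₚ.*-identityˡ _ ⟩
    geom 0 N                      ≡⟨ sumFromTo-0 N _ ⟩
    ∑[ k < L ] mono (0 * k) N     ≡⟨ ∑<-zero L (λ _ _ → refl) ⟩
    0ℤ                            ∎)
    where open ≡-Reasoning

  H-vanishes : ∀ {n} → L ≤ n → H n ≡ 0ℤ
  H-vanishes {n} L≤n = begin
    -1ℤ ℤ.^ suc n ℤ.* (mono T ⊛ geom n) N               ≡⟨ cong (-1ℤ ℤ.^ suc n ℤ.*_) (mono-⊛ T (geom n) N) ⟩
    -1ℤ ℤ.^ suc n ℤ.* (𝟙 (T ≤? N) ℤ.* geom n (N ∸ T))  ≡⟨ cong (λ c → -1ℤ ℤ.^ suc n ℤ.* (c ℤ.* geom n (N ∸ T))) T≰N ⟩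
    -1ℤ ℤ.^ suc n ℤ.* 0ℤ                                ≡⟨ ℤₚ.*-zeroʳ (-1ℤ ℤ.^ suc n) ⟩
    0ℤ                                                   ∎
    where
    open ≡-Reasoning
    T : ℕ
    T = n * suc n / 2
    T≰N : 𝟙 (T ≤? N) ≡ 0ℤ
    T≰N = 𝟙-no (T ≤? N) (ℕₚ.<⇒≱ (ℕₚ.<-≤-trans L≤n (n≤triangle n)))

  H-odd : ∀ {j} → j < L → H (suc (j + j)) ≡ oddTerm j
  H-odd {j} j<L = begin
    -1ℤ ℤ.^ suc n ℤ.* (mono T ⊛ geom n) N
      ≡⟨ cong₂ ℤ._*_ (cong (λ s → -1ℤ ℤ.* (-1ℤ ℤ.* s)) (-1^[n+n]≡1 j)) (mono-⊛-geom T (j + j) N) ⟩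
    1ℤ ℤ.* ∑[ k < L ] mono (T + n * k) N
      ≡⟨ ℤₚ.*-identityˡ _ ⟩
    ∑[ k < L ] mono (T + n * k) N
      ≡⟨ ∑<-cong L (λ k _ → cong (λ m → mono m N) (exponent k)) ⟩
    ∑[ k < L ] δ n (suc j + k)
      ≡⟨ sym (∑<-from-support (δ n) (λ v → δ-vanishesʳ n) (ℕₚ.≤-trans j<L L≤M) L≤M) ⟩
    ∑[ v < M ] (δ n v ℤ.* 𝟙 (suc j ≤? v))
      ≡⟨ ∑<-cong M (λ v _ → cong (δ n v ℤ.*_) (𝟙-cong (suc j ≤? v) (n ≤? v + v) to from)) ⟩
    oddTerm j ∎
    where
    open ≡-Reasoning
    n T : ℕ
    n = suc (j + j)
    T = n * suc n / 2
    exponent : ∀ k → T + n * k ≡ n * (suc j + k)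
    exponent k = trans (cong (_+ n * k) (odd-triangle j)) (sym (ℕₚ.*-distribˡ-+ n (suc j) k))
    to : ∀ {v} → suc j ≤ v → n ≤ v + v
    to j<v = ℕₚ.+-mono-≤ j<v (ℕₚ.≤-trans (ℕₚ.n≤1+n j) j<v)
    from : ∀ {v} → n ≤ v + v → suc j ≤ v
    from {v} n≤2v = ℕₚ.≰⇒> λ v≤j → ℕₚ.<⇒≱ (s≤s (ℕₚ.+-mono-≤ v≤j v≤j)) n≤2v

  H-even : ∀ {j} → j < L → H (j + j) ≡ ℤ.- evenTerm j
  H-even {zero}   _   = trans H-zero (cong ℤ.-_ (sym (∑<-zero L (λ _ _ → refl))))
  H-even {suc j′} j<L = begin
    -1ℤ ℤ.^ suc n ℤ.* (mono T ⊛ geom n) N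
      ≡⟨ cong₂ ℤ._*_ (cong (-1ℤ ℤ.*_) (-1^[n+n]≡1 j)) (mono-⊛-geom T (j′ + j) N) ⟩
    -1ℤ ℤ.* ∑[ k < L ] mono (T + n * k) N
      ≡⟨ ℤₚ.-1*i≡-i _ ⟩
    ℤ.- ∑[ k < L ] mono (T + n * k) N
      ≡⟨ cong ℤ.-_ (∑<-cong L (λ k _ → cong (λ m → mono m N) (exponent k))) ⟩
    ℤ.- ∑[ k < L ] g (j + k)
      ≡⟨ cong ℤ.-_ (sym (∑<-from-support g support (ℕₚ.<⇒≤ j<L) ℕₚ.≤-refl)) ⟩
    ℤ.- ∑[ b < L ] (g b ℤ.* 𝟙 (j ≤? b))
      ≡⟨ cong ℤ.-_ (∑<-cong L (λ b _ → cong (g b ℤ.*_) (𝟙-cong (j ≤? b) (n ≤? suc (b + b)) to from))) ⟩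
    ℤ.- evenTerm j ∎
    where
    open ≡-Reasoning
    j n T : ℕ
    j = suc j′
    n = j + j
    T = n * suc n / 2
    g : ℕ → ℤ
    g b = δ j (suc (b + b))
    support : ∀ b → L ≤ b → g b ≡ 0ℤ
    support b L≤b = δ-vanishesʳ j (ℕₚ.≤-trans L≤b (ℕₚ.≤-trans (ℕₚ.m≤m+n b b) (ℕₚ.n≤1+n (b + b))))
    exponent : ∀ k → T + n * k ≡ j * suc ((j + k) + (j + k))
    exponent k = trans (cong (_+ n * k) (even-triangle j)) (ring j k)
      where
      ring : ∀ j k → j * suc (j + j) + (j + j) * k ≡ j * suc ((j + k) + (j + k))
      ring = ℕ-Ring.solve-∀
    to : ∀ {b} → j ≤ b → n ≤ suc (b + b)
    to j≤b = ℕₚ.≤-trans (ℕₚ.+-mono-≤ j≤b j≤b) (ℕₚ.n≤1+n _)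
    from : ∀ {b} → n ≤ suc (b + b) → j ≤ b
    from {b} n≤2b+1 = ℕₚ.≮⇒≥ λ b<j →
      ℕₚ.<⇒≱ (subst (suc (b + b) <_) (sym (ℕₚ.+-suc (suc b) b)) ℕₚ.≤-refl)
             (ℕₚ.≤-trans (ℕₚ.+-mono-≤ b<j b<j) n≤2b+1)

  h-coefficient : h N ≡ ∑< L oddTerm ℤ.- ∑< L evenTerm
  h-coefficient = begin
    h N                                              ≡⟨ sumFromTo-1 N _ ⟩
    ∑< N (H ∘ suc)                                   ≡⟨ sym (ℤₚ.+-identityˡ _) ⟩
    0ℤ ℤ.+ ∑< N (H ∘ suc)                            ≡⟨ cong (ℤ._+ ∑< N (H ∘ suc)) (sym H-zero) ⟩
    H 0 ℤ.+ ∑< N (H ∘ suc)                           ≡⟨ sym (∑<-suc N H) ⟩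
    ∑< L H                                           ≡⟨ sym (∑<-vanishing L≤M (λ n L≤n _ → H-vanishes L≤n)) ⟩
    ∑< (L + L) H                                     ≡⟨ ∑<-parity L H ⟩
    ∑[ j < L ] (H (j + j) ℤ.+ H (suc (j + j)))      ≡⟨ ∑<-cong L (λ j j<L → cong₂ ℤ._+_ (H-even j<L) (H-odd j<L)) ⟩
    ∑[ j < L ] (ℤ.- evenTerm j ℤ.+ oddTerm j)       ≡⟨ ∑<-cong L (λ j _ → ℤₚ.+-comm (ℤ.- evenTerm j) (oddTerm j)) ⟩
    ∑[ j < L ] (oddTerm j ℤ.- evenTerm j)           ≡⟨ ∑<-- L oddTerm evenTerm ⟩
    ∑< L oddTerm ℤ.- ∑< L evenTerm                   ∎
    where open ≡-Reasoning

  rhs-summand-coefficient : ∀ u → let U = suc u in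
    rhs-summand U N ≡ ∑[ i < U ] δ U (U + i) ℤ.+ ∑[ i < U ] δ U (suc U + i)
  rhs-summand-coefficient u = begin
    (mono (U * U) ⊛ inner) N
      ≡⟨ mono-⊛ (U * U) inner N ⟩
    c ℤ.* (mono 0 r ℤ.+ ℤ.+ 2 ℤ.* sumFromTo 1 u (λ i → mono (i * U) r) ℤ.+ mono (U * U) r)
      ≡⟨ distribute c (mono 0 r) (sumFromTo 1 u (λ i → mono (i * U) r)) (mono (U * U) r) ⟩
    c ℤ.* mono 0 r ℤ.+ ℤ.+ 2 ℤ.* (c ℤ.* sumFromTo 1 u (λ i → mono (i * U) r)) ℤ.+ c ℤ.* mono (U * U) r
      ≡⟨ cong₂ ℤ._+_ (cong₂ ℤ._+_ (mono-shift (U * U) 0 N) (cong (ℤ.+ 2 ℤ.*_) interior)) (mono-shift (U * U) (U * U) N) ⟩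
    x 0 ℤ.+ ℤ.+ 2 ℤ.* ∑< u (x ∘ suc) ℤ.+ x U
      ≡⟨ overlapping-sums u x ⟩
    ∑< U x ℤ.+ ∑< U (x ∘ suc)
      ≡⟨ cong₂ ℤ._+_ (∑<-cong U (λ i _ → cong (λ m → mono m N) (square-shift i)))
                     (∑<-cong U (λ i _ → cong (λ m → mono m N) (trans (square-shift (suc i)) (cong (U *_) (ℕₚ.+-suc U i))))) ⟩
    ∑[ i < U ] δ U (U + i) ℤ.+ ∑[ i < U ] δ U (suc U + i) ∎
    where
    open ≡-Reasoning
    U r : ℕ
    U = suc u
    r = N ∸ U * U
    inner : Series
    inner = mono 0 ⊕ (ℤ.+ 2) · finSum 1 u (λ i → mono (i * U)) ⊕ mono (U * U)
    c : ℤ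
    c = 𝟙 (U * U ≤? N)
    x : ℕ → ℤ
    x i = mono (U * U + i * U) N
    distribute : ∀ c a s b → c ℤ.* (a ℤ.+ ℤ.+ 2 ℤ.* s ℤ.+ b) ≡ c ℤ.* a ℤ.+ ℤ.+ 2 ℤ.* (c ℤ.* s) ℤ.+ c ℤ.* b
    distribute = ℤ-Ring.solve-∀
    interior : c ℤ.* sumFromTo 1 u (λ i → mono (i * U) r) ≡ ∑< u (x ∘ suc)
    interior = begin
      c ℤ.* sumFromTo 1 u (λ i → mono (i * U) r)     ≡⟨ cong (c ℤ.*_) (sumFromTo-1 u _) ⟩
      c ℤ.* ∑[ i < u ] mono (suc i * U) r            ≡⟨ sym (∑<-*ˡ u c _) ⟩
      ∑[ i < u ] (c ℤ.* mono (suc i * U) r)          ≡⟨ ∑<-cong u (λ i _ → mono-shift (U * U) (suc i * U) N) ⟩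
      ∑< u (x ∘ suc)                                 ∎
    square-shift : ∀ i → U * U + i * U ≡ U * (U + i)
    square-shift i = ring U i
      where
      ring : ∀ U i → U * U + i * U ≡ U * (U + i)
      ring = ℕ-Ring.solve-∀

  V : ℕ → ℤ
  V u = ∑[ v < M ] (δ u v ℤ.* W u v)

  V-intervals : ∀ {U} → U < L → V U ≡ ∑[ i < U ] δ U (U + i) ℤ.+ ∑[ i < U ] δ U (suc U + i)
  V-intervals {U} U<L = begin
    ∑[ v < M ] (δ U v ℤ.* W U v)
      ≡⟨ trans (∑<-cong M (λ v _ → ℤₚ.*-distribˡ-+ (δ U v) _ _)) (∑<-+ M _ _) ⟩
    ∑[ v < M ] (δ U v ℤ.* (𝟙 (U ≤? v) ℤ.* 𝟙 (v <? U + U)))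
      ℤ.+ ∑[ v < M ] (δ U v ℤ.* (𝟙 (suc U ≤? v) ℤ.* 𝟙 (v <? suc (U + U))))
      ≡⟨ cong₂ ℤ._+_ (∑<-interval (δ U) (ℕₚ.m≤m+n U U) (ℕₚ.+-mono-≤ U≤L U≤L))
                     (∑<-interval (δ U) (s≤s (ℕₚ.m≤m+n U U)) (ℕₚ.+-mono-≤ U<L U≤L)) ⟩
    ∑[ i < U + U ∸ U ] δ U (U + i) ℤ.+ ∑[ i < U + U ∸ U ] δ U (suc U + i)
      ≡⟨ cong (λ k → ∑[ i < k ] δ U (U + i) ℤ.+ ∑[ i < k ] δ U (suc U + i)) (ℕₚ.m+n∸m≡n U U) ⟩
    ∑[ i < U ] δ U (U + i) ℤ.+ ∑[ i < U ] δ U (suc U + i) ∎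
    where
    open ≡-Reasoning
    U≤L : U ≤ L
    U≤L = ℕₚ.<⇒≤ U<L

  rhs-coefficient : rhs N ≡ σ W
  rhs-coefficient = begin
    rhs N                              ≡⟨ sumFromTo-1 N _ ⟩
    ∑[ u < N ] rhs-summand (suc u) N   ≡⟨ ∑<-cong N (λ u u<N → trans (rhs-summand-coefficient u) (sym (V-intervals (s≤s u<N)))) ⟩
    ∑< N (V ∘ suc)                     ≡⟨ sym (∑<-vanishing (ℕₚ.m≤m+n N L) (λ u N≤u _ → V-vanishes (s≤s N≤u))) ⟩
    ∑< (N + L) (V ∘ suc)               ≡⟨ sym (ℤₚ.+-identityˡ _) ⟩
    0ℤ ℤ.+ ∑< (N + L) (V ∘ suc)        ≡⟨ cong (ℤ._+ ∑< (N + L) (V ∘ suc)) (sym (∑<-zero M (λ _ _ → refl))) ⟩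
    V 0 ℤ.+ ∑< (N + L) (V ∘ suc)       ≡⟨ sym (∑<-suc (N + L) V) ⟩
    ∑< M V                             ∎
    where
    open ≡-Reasoning
    V-vanishes : ∀ {u} → L ≤ u → V u ≡ 0ℤ
    V-vanishes L≤u = ∑<-zero M (λ v _ → δ-weighted-vanishesˡ v _ L≤u)

  coefficient : h N ≡ rhs N
  coefficient = begin
    h N                                                            ≡⟨ h-coefficient ⟩
    ∑< L oddTerm ℤ.- ∑< L evenTerm                                 ≡⟨ cancel shared (∑< L oddTerm) (∑< L evenTerm) ⟩
    (shared ℤ.+ ∑< L oddTerm) ℤ.- (shared ℤ.+ ∑< L evenTerm)       ≡⟨ sym (cong₂ ℤ._-_ σ-≤-double σ-double-≤) ⟩
    σ (λ u v → 𝟙 (u ≤? v + v)) ℤ.- σ (λ u v → 𝟙 (u + u ≤? v))     ≡⟨ sym σ-W ⟩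
    σ W                                                            ≡⟨ sym rhs-coefficient ⟩
    rhs N                                                          ∎
    where
    open ≡-Reasoning
    cancel : ∀ s o e → o ℤ.- e ≡ (s ℤ.+ o) ℤ.- (s ℤ.+ e)
    cancel = ℤ-Ring.solve-∀

lemma2p2 : h ≈ₛ rhs
lemma2p2 zero      = refl
lemma2p2 (suc N′) = Coefficient.coefficient N′
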